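{- There exist infinitely many (pairwise non-isomorphic) finite posets $P=(X,\prec)$ of width three such that, for each of them, there are distinct elements $z_1,z_2,z_3\in X$ and integers $k,\ell\ge1$ with $$\mathrm{F}(k,\ell+2)\,\mathrm{F}(k+1,\ell)\ >\ \mathrm{F}(k,\ell+1)\,\mathrm{F}(k+1,\ell+1),$$ where $\mathrm{F}(a,b)$ is the number of linear extensions $L$ of $P$ with $L(z_2)-L(z_1)=a$ and $L(z_3)-L(z_2)=b$.
   Context: A linear extension of a finite poset $P=(X,\prec)$ with $|X|=n$ is a bijection $L:X\to\{1,\dots,n\}$ with $L(u)<L(v)$ whenever $u\prec v$. The width of a poset is the maximal size of an antichain. -}

module Defs where

open import Data.Nat using (ℕ; zero; suc; _+_; _<_)
open import Data.Fin using (Fin; toℕ)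
open import Data.Fin.Properties using (all?; any?) renaming (_≟_ to _≟ᶠ_)
open import Data.Vec using (Vec; []; _∷_; lookup)
open import Data.List using (List; []; _∷_; [_]; map; concatMap; allFin; filter; length)
open import Data.Product using (Σ; ∃; _×_; _,_)
open import Relation.Nullary using (¬_; Dec)
open import Relation.Nullary.Decidable using (_×-dec_; _→-dec_; ¬?)
open import Relation.Binary using (Rel; Decidable; IsStrictPartialOrder)
open import Relation.Binary.PropositionalEquality using (_≡_; _≢_)
import Data.Nat.Properties as ℕP

record FinPoset : Set₁ where
  field
    size    : ℕ
    _≺_     : Rel (Fin size) _
    isSPO   : IsStrictPartialOrder _≡_ _≺_
    _≺?_    : Decidable _≺_

open FinPoset public

Incomparable : (P : FinPoset) → Fin (size P) → Fin (size P) → Set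
Incomparable P x y = ¬ (_≺_ P x y) × ¬ (_≺_ P y x)

HasAntichainOfSize : (P : FinPoset) → ℕ → Set
HasAntichainOfSize P k =
  Σ (Fin k → Fin (size P)) λ f →
    (∀ i j → i ≢ j → f i ≢ f j) × (∀ i j → i ≢ j → Incomparable P (f i) (f j))

HasWidth : FinPoset → ℕ → Set
HasWidth P w = HasAntichainOfSize P w × (∀ k → HasAntichainOfSize P k → k Data.Nat.≤ w)

Isomorphic : FinPoset → FinPoset → Set
Isomorphic P Q =
  Σ (Fin (size P) → Fin (size Q)) λ f →
  Σ (Fin (size Q) → Fin (size P)) λ g →
    (∀ x → g (f x) ≡ x) × (∀ y → f (g y) ≡ y) ×
    (∀ x y → (_≺_ P x y → _≺_ Q (f x) (f y)) × (_≺_ Q (f x) (f y) → _≺_ P x y))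

-- A linear extension, with positions 0,…,n-1 instead of 1,…,n
-- (only differences of positions matter below): a bijection
-- L : X → {0,…,n-1} with L u < L v whenever u ≺ v.
IsLinearExtension : (P : FinPoset) → (Fin (size P) → Fin (size P)) → Set
IsLinearExtension P L =
  (∀ u v → L u ≡ L v → u ≡ v) ×
  (∀ j → ∃ λ u → L u ≡ j) ×
  (∀ u v → _≺_ P u v → toℕ (L u) < toℕ (L v))

isLinearExtension? : (P : FinPoset) → (L : Fin (size P) → Fin (size P)) →
                     Dec (IsLinearExtension P L)
isLinearExtension? P L =
  all? (λ u → all? (λ v → (L u ≟ᶠ L v) →-dec (u ≟ᶠ v))) ×-dec
  all? (λ j → any? (λ u → L u ≟ᶠ j)) ×-dec
  all? (λ u → all? (λ v → (_≺?_ P u v) →-dec (toℕ (L u) ℕP.<? toℕ (L v))))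

allVecs : ∀ n k → List (Vec (Fin n) k)
allVecs n zero    = [ [] ]
allVecs n (suc k) = concatMap (λ i → map (i ∷_) (allVecs n k)) (allFin n)

Gaps : (P : FinPoset) → (z₁ z₂ z₃ : Fin (size P)) → ℕ → ℕ →
       (Fin (size P) → Fin (size P)) → Set
Gaps P z₁ z₂ z₃ a b L = (toℕ (L z₂) ≡ toℕ (L z₁) + a) × (toℕ (L z₃) ≡ toℕ (L z₂) + b)

F : (P : FinPoset) → (z₁ z₂ z₃ : Fin (size P)) → ℕ → ℕ → ℕ
F P z₁ z₂ z₃ a b =
  length (filter (λ v → isLinearExtension? P (lookup v) ×-dec
                        ((toℕ (lookup v z₂) ℕP.≟ toℕ (lookup v z₁) + a) ×-dec
                         (toℕ (lookup v z₃) ℕP.≟ toℕ (lookup v z₂) + b)))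
                 (allVecs (size P) (size P)))

HasViolation : FinPoset → Set
HasViolation P =
  Σ (Fin (size P)) λ z₁ → Σ (Fin (size P)) λ z₂ → Σ (Fin (size P)) λ z₃ →
  (z₁ ≢ z₂) × (z₁ ≢ z₃) × (z₂ ≢ z₃) ×
  Σ ℕ λ k → Σ ℕ λ ℓ → (1 Data.Nat.≤ k) × (1 Data.Nat.≤ ℓ) ×
    (F P z₁ z₂ z₃ k (ℓ + 2) * F P z₁ z₂ z₃ (k + 1) ℓ >
     F P z₁ z₂ z₃ k (ℓ + 1) * F P z₁ z₂ z₃ (k + 1) (ℓ + 1))
  where open Data.Nat using (_*_; _>_)

{-# OPTIONS --safe #-}
module Submission where

-- The posets are Q ⊕ Cₘ: the six-element disjoint union of chains Q = C₃ + C₂ + C₁ with an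
-- m-element chain placed above it. Every element of the top chain is above all elements of
-- smaller index and below all of larger index, so a linear extension of Q ⊕ Cₘ fixes the chain
-- and restricts to a linear extension of Q; conversely each linear extension of Q extends. So F
-- is the same for Q ⊕ Cₘ as for Q, where the inequality holds for k = ℓ = 1 by enumeration.
-- Three chains cover Q ⊕ Cₘ and it contains a 3-antichain, so its width is 3; the sizes 6 + m
-- tell the posets apart.

open import Defs
open import Data.Nat using (ℕ; zero; suc; _+_; _∸_; _*_; _≤_; _<_; _>_; s≤s; s≤s⁻¹; z≤n)
open import Data.Nat.Properties
  using (≤-antisym; <-≤-trans; <-irrefl; <-asym; m≤m+n; +-comm; +-cancelˡ-≡; +-cancelˡ-<; +-monoʳ-<;
         m∸n≤m; ∸-monoʳ-<; ∸-cancelʳ-≤; m+n≤o⇒m≤o∸n; m≤o∸n⇒m+n≤o)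
open import Data.Fin using (Fin; zero; #_; toℕ; fromℕ<; inject≤; opposite; splitAt; join; _↑ˡ_; _↑ʳ_)
import Data.Fin as Fin
open import Data.Fin.Properties
  using (fromℕ<-injective; toℕ-injective; toℕ<n; toℕ≤n; toℕ-inject≤; inject≤-injective;
         injective⇒≤; opposite-prop; opposite-involutive; toℕ-↑ˡ; toℕ-↑ʳ; ↑ˡ-injective;
         splitAt-↑ˡ; splitAt-↑ʳ; splitAt-join; join-splitAt; all?; <-cmp)
  renaming (_≟_ to _≟ᶠ_)
import Data.Fin.Properties as Finₚ
open import Data.Vec using (Vec; []; _∷_; lookup; tabulate)
open import Data.Vec.Properties using (lookup∘tabulate; tabulate∘lookup; tabulate-cong)
open import Data.List using (List; map; allFin; filter; length)
open import Data.List.Properties using (length-map)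
open import Data.List.Membership.Propositional using (_∈_)
open import Data.List.Membership.Propositional.Properties
  using (∈-map⁺; ∈-map⁻; ∈-concatMap⁺; ∈-allFin; ∈-filter⁺; ∈-filter⁻)
open import Data.List.Membership.Propositional.Properties.WithK using (unique∧set⇒bag)
open import Data.List.Relation.Binary.BagAndSetEquality using (_∼[_]_; set; ∼bag⇒↭)
open import Data.List.Relation.Binary.Permutation.Propositional.Properties using (↭-length)
open import Data.List.Relation.Binary.Disjoint.Propositional using (Disjoint)
open import Data.List.Relation.Unary.Any using (here)
import Data.List.Relation.Unary.Any as Any
import Data.List.Relation.Unary.All as All
import Data.List.Relation.Unary.AllPairs as AllPairs
import Data.List.Relation.Unary.AllPairs.Properties as AllPairs
open import Data.List.Relation.Unary.Unique.Propositional using (Unique)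
import Data.List.Relation.Unary.Unique.Propositional.Properties as Unique
open import Data.Product using (Σ; ∃; _×_; _,_; proj₁; proj₂)
open import Data.Sum using (_⊎_; inj₁; inj₂; map₁; [_,_]′)
import Data.Sum as Sum
open import Data.Sum.Properties using (map₁-cong; inj₁-injective; inj₂-injective)
open import Data.Sum.Relation.Binary.LeftOrder
  using (_⊎-<_; ₁∼₁; ₁∼₂; ₂∼₂; drop-inj₁; drop-inj₂;
         ⊎-<-irreflexive; ⊎-<-transitive; ⊎-<-decidable)
open import Data.Sum.Relation.Binary.Pointwise
  using (Pointwise; ⊎-irreflexive; ⊎-transitive; ⊎-decidable; ≡⇒Pointwise-≡)
import Data.Sum.Relation.Binary.Pointwise as Pointwise
open import Data.Empty using (⊥-elim)
open import Function.Base using (_on_; _∘_; const)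
open import Function.Bundles using (mk⇔)
open import Relation.Nullary using (¬_; Dec; yes; no)
open import Relation.Nullary.Decidable using (_×-dec_; _→-dec_; ¬?; toWitness)
open import Relation.Binary using (Rel; Irreflexive; Transitive; Decidable; Tri; tri<; tri≈; tri>)
open import Relation.Binary.Structures using (IsStrictPartialOrder)
open import Relation.Binary.PropositionalEquality
  using (_≡_; _≢_; _≗_; refl; sym; trans; cong; cong₂; subst; subst₂; isEquivalence; resp₂;
         module ≡-Reasoning)
import Data.Nat.Properties as ℕₚ
open import Level using (0ℓ)

-- Counting linear extensions

allVecs-complete : ∀ n k (v : Vec (Fin n) k) → v ∈ allVecs n k
allVecs-complete n zero    []      = here refl
allVecs-complete n (suc k) (i ∷ v) =
  ∈-concatMap⁺ _ (Any.map (λ { refl → ∈-map⁺ (i ∷_) (allVecs-complete n k v) }) (∈-allFin i))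

allVecs-unique : ∀ n k → Unique (allVecs n k)
allVecs-unique n zero    = All.[] AllPairs.∷ AllPairs.[]
allVecs-unique n (suc k) = Unique.concat⁺ (All.tabulate prefixed-unique)
  (AllPairs.map⁺ (AllPairs.map prefixed-disjoint (Unique.tabulate⁺ λ eq → eq)))
  where
  prefixed : Fin n → List (Vec (Fin n) (suc k))
  prefixed i = map (i ∷_) (allVecs n k)
  prefixed-unique : ∀ {xs} → xs ∈ map prefixed (allFin n) → Unique xs
  prefixed-unique mem with ∈-map⁻ prefixed mem
  ... | _ , _ , refl = Unique.map⁺ (λ { refl → refl }) (allVecs-unique n k)
  prefixed-disjoint : ∀ {i j} → i ≢ j → Disjoint (prefixed i) (prefixed j)
  prefixed-disjoint i≢j (p , q) with ∈-map⁻ _ p | ∈-map⁻ _ q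
  ... | _ , _ , refl | _ , _ , refl = i≢j refl

length-unique-set : ∀ {A : Set} {xs ys : List A} → Unique xs → Unique ys → xs ∼[ set ] ys →
                    length xs ≡ length ys
length-unique-set ux uy xs∼ys = ↭-length (∼bag⇒↭ (unique∧set⇒bag ux uy xs∼ys))

Counted : (P : FinPoset) (z₁ z₂ z₃ : Fin (size P)) (k ℓ : ℕ) → Vec (Fin (size P)) (size P) → Set
Counted P z₁ z₂ z₃ k ℓ v = IsLinearExtension P (lookup v) × Gaps P z₁ z₂ z₃ k ℓ (lookup v)

counted? : ∀ P z₁ z₂ z₃ k ℓ v → Dec (Counted P z₁ z₂ z₃ k ℓ v)
counted? P z₁ z₂ z₃ k ℓ v = isLinearExtension? P (lookup v) ×-dec
  ((toℕ (lookup v z₂) ℕₚ.≟ toℕ (lookup v z₁) + k) ×-dec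
   (toℕ (lookup v z₃) ℕₚ.≟ toℕ (lookup v z₂) + ℓ))

-- By definition, F P z₁ z₂ z₃ k ℓ is length (countedVecs P z₁ z₂ z₃ k ℓ).
countedVecs : ∀ P (z₁ z₂ z₃ : Fin (size P)) (k ℓ : ℕ) → List (Vec (Fin (size P)) (size P))
countedVecs P z₁ z₂ z₃ k ℓ = filter (counted? P z₁ z₂ z₃ k ℓ) (allVecs (size P) (size P))

countedVecs-unique : ∀ P z₁ z₂ z₃ k ℓ → Unique (countedVecs P z₁ z₂ z₃ k ℓ)
countedVecs-unique P z₁ z₂ z₃ k ℓ =
  Unique.filter⁺ (counted? P z₁ z₂ z₃ k ℓ) (allVecs-unique (size P) (size P))

∈-countedVecs⁺ : ∀ {P z₁ z₂ z₃ k ℓ v} → Counted P z₁ z₂ z₃ k ℓ v → v ∈ countedVecs P z₁ z₂ z₃ k ℓ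
∈-countedVecs⁺ {P} {z₁} {z₂} {z₃} {k} {ℓ} {v} =
  ∈-filter⁺ (counted? P z₁ z₂ z₃ k ℓ) (allVecs-complete (size P) (size P) v)

∈-countedVecs⁻ : ∀ {P z₁ z₂ z₃ k ℓ v} → v ∈ countedVecs P z₁ z₂ z₃ k ℓ → Counted P z₁ z₂ z₃ k ℓ v
∈-countedVecs⁻ {P} {z₁} {z₂} {z₃} {k} {ℓ} =
  proj₂ ∘ ∈-filter⁻ (counted? P z₁ z₂ z₃ k ℓ) {xs = allVecs (size P) (size P)}

isLinearExtension-cong : ∀ P {L L′ : Fin (size P) → Fin (size P)} → L ≗ L′ →
                         IsLinearExtension P L → IsLinearExtension P L′
isLinearExtension-cong P L≗L′ (injective , surjective , monotone) =
  (λ u v eq → injective u v (trans (L≗L′ u) (trans eq (sym (L≗L′ v))))) ,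
  (λ j → let u , Lu≡j = surjective j in u , trans (sym (L≗L′ u)) Lu≡j) ,
  (λ u v u≺v → subst₂ _<_ (cong toℕ (L≗L′ u)) (cong toℕ (L≗L′ v)) (monotone u v u≺v))

Gaps-cong : ∀ {P Q : FinPoset} {z₁ z₂ z₃ y₁ y₂ y₃ k ℓ}
            (L : Fin (size P) → Fin (size P)) (M : Fin (size Q) → Fin (size Q)) →
            toℕ (L z₁) ≡ toℕ (M y₁) → toℕ (L z₂) ≡ toℕ (M y₂) → toℕ (L z₃) ≡ toℕ (M y₃) →
            Gaps P z₁ z₂ z₃ k ℓ L → Gaps Q y₁ y₂ y₃ k ℓ M
Gaps-cong {k = k} {ℓ} L M e₁ e₂ e₃ (gap₁ , gap₂) =
  trans (sym e₂) (trans gap₁ (cong (_+ k) e₁)) , trans (sym e₃) (trans gap₂ (cong (_+ ℓ) e₂))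

Violates : (P : FinPoset) (z₁ z₂ z₃ : Fin (size P)) (k ℓ : ℕ) → Set
Violates P z₁ z₂ z₃ k ℓ =
  F P z₁ z₂ z₃ k (ℓ + 2) * F P z₁ z₂ z₃ (k + 1) ℓ >
  F P z₁ z₂ z₃ k (ℓ + 1) * F P z₁ z₂ z₃ (k + 1) (ℓ + 1)

-- Positions in a linear extension

<∸suc-swap : ∀ {i t n} → t < n → i < n ∸ suc t → t < n ∸ suc i
<∸suc-swap {i} {t} {n} t<n i<n∸t = m+n≤o⇒m≤o∸n (suc t)
  (subst (_≤ n) (+-comm (suc i) (suc t)) (m≤o∸n⇒m+n≤o (suc i) t<n i<n∸t))

opposite-injective : ∀ {n} {i j : Fin n} → opposite i ≡ opposite j → i ≡ j
opposite-injective {i = i} {j} eq =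
  trans (sym (opposite-involutive i)) (trans (cong opposite eq) (opposite-involutive j))

module _ (P : FinPoset) {L : Fin (size P) → Fin (size P)} (isLE : IsLinearExtension P L) where

  private
    N = size P
    L-injective = proj₁ isLE
    L-monotone  = proj₂ (proj₂ isLE)

  index≤position : ∀ x → (∀ u → toℕ u < toℕ x → _≺_ P u x) → toℕ x ≤ toℕ (L x)
  index≤position x below = injective⇒≤ {f = g} g-injective
    where
    u : Fin (toℕ x) → Fin N
    u i = inject≤ i (toℕ≤n x)
    g : Fin (toℕ x) → Fin (toℕ (L x))
    g i = fromℕ< (L-monotone (u i) x (below (u i) (subst (_< toℕ x) (sym (toℕ-inject≤ i _)) (toℕ<n i))))
    g-injective : ∀ {i j} → g i ≡ g j → i ≡ j
    g-injective {i} {j} eq =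
      inject≤-injective _ _ i j (L-injective (u i) (u j) (toℕ-injective (fromℕ<-injective _ _ _ _ eq)))

  -- Dual to index≤position: opposite mirrors the positions above L x to positions below N ∸ suc (L x).
  position≤index : ∀ x → (∀ u → toℕ x < toℕ u → _≺_ P x u) → toℕ (L x) ≤ toℕ x
  position≤index x above = s≤s⁻¹ (∸-cancelʳ-≤ (toℕ<n (L x)) (injective⇒≤ {f = g} g-injective))
    where
    u : Fin (N ∸ suc (toℕ x)) → Fin N
    u i = opposite (inject≤ i (m∸n≤m N (suc (toℕ x))))
    x<u : ∀ i → toℕ x < toℕ (u i)
    x<u i = subst (toℕ x <_) (sym (trans (opposite-prop _) (cong (λ t → N ∸ suc t) (toℕ-inject≤ i _))))
                  (<∸suc-swap (toℕ<n x) (toℕ<n i))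
    g : Fin (N ∸ suc (toℕ x)) → Fin (N ∸ suc (toℕ (L x)))
    g i = fromℕ< (subst (_< N ∸ suc (toℕ (L x))) (sym (opposite-prop (L (u i))))
                   (∸-monoʳ-< (s≤s (L-monotone x (u i) (above (u i) (x<u i)))) (toℕ<n (L (u i)))))
    g-injective : ∀ {i j} → g i ≡ g j → i ≡ j
    g-injective {i} {j} eq = inject≤-injective _ _ i j (opposite-injective (L-injective (u i) (u j)
      (opposite-injective (toℕ-injective (fromℕ<-injective _ _ _ _ eq)))))

-- Posets on Fin (a + b)

data Split (a b : ℕ) : Fin (a + b) → Set where
  left  : (i : Fin a) → Split a b (i ↑ˡ b)
  right : (j : Fin b) → Split a b (a ↑ʳ j)

split : ∀ a b (x : Fin (a + b)) → Split a b x
split a b x = subst (Split a b) (join-splitAt a b x) (view (splitAt a x))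
  where
  view : (s : Fin a ⊎ Fin b) → Split a b (join a b s)
  view (inj₁ i) = left i
  view (inj₂ j) = right j

join-injective : ∀ a b {s t : Fin a ⊎ Fin b} → join a b s ≡ join a b t → s ≡ t
join-injective a b {s} {t} eq =
  trans (sym (splitAt-join a b s)) (trans (cong (splitAt a) eq) (splitAt-join a b t))

splitAt-injective : ∀ a b {x y : Fin (a + b)} → splitAt a x ≡ splitAt a y → x ≡ y
splitAt-injective a b {x} {y} eq = trans (sym (join-splitAt a b x)) (trans (cong (join a b) eq) (join-splitAt a b y))

↑ˡ<↑ʳ : ∀ {a b} (i : Fin a) (j : Fin b) → toℕ (i ↑ˡ b) < toℕ (a ↑ʳ j)
↑ˡ<↑ʳ {a} {b} i j =
  subst₂ _<_ (sym (toℕ-↑ˡ i b)) (sym (toℕ-↑ʳ a j)) (<-≤-trans (toℕ<n i) (m≤m+n a (toℕ j)))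

↑ˡ≢↑ʳ : ∀ {a b} (i : Fin a) (j : Fin b) → i ↑ˡ b ≢ a ↑ʳ j
↑ˡ≢↑ʳ i j eq = <-irrefl (cong toℕ eq) (↑ˡ<↑ʳ i j)

module _ {a b ℓ} (R : Rel (Fin a ⊎ Fin b) ℓ) {s t : Fin a ⊎ Fin b} where

  on-join⁺ : R s t → (R on splitAt a) (join a b s) (join a b t)
  on-join⁺ = subst₂ R (sym (splitAt-join a b s)) (sym (splitAt-join a b t))

  on-join⁻ : (R on splitAt a) (join a b s) (join a b t) → R s t
  on-join⁻ = subst₂ R (splitAt-join a b s) (splitAt-join a b t)

alongSplitAt : ∀ a b (R : Rel (Fin a ⊎ Fin b) 0ℓ) →
               Irreflexive _≡_ R → Transitive R → Decidable R → FinPoset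
alongSplitAt a b R irr tr dec = record
  { size  = a + b
  ; _≺_   = R on splitAt a
  ; isSPO = record
    { isEquivalence = isEquivalence
    ; irrefl        = λ { refl → irr refl }
    ; trans         = tr
    ; <-resp-≈      = resp₂ _ }
  ; _≺?_  = λ x y → dec (splitAt a x) (splitAt a y) }

chain : ℕ → FinPoset
chain k = record { size = k ; _≺_ = Fin._<_ ; isSPO = Finₚ.<-isStrictPartialOrder ; _≺?_ = Finₚ._<?_ }

private
  module SPO (A : FinPoset) = IsStrictPartialOrder (isSPO A)

_⊎ᴾ_ : FinPoset → FinPoset → FinPoset
A ⊎ᴾ B = alongSplitAt (size A) (size B) (Pointwise (_≺_ A) (_≺_ B))
  (⊎-irreflexive (SPO.irrefl A) (SPO.irrefl B) ∘ ≡⇒Pointwise-≡)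
  (⊎-transitive (SPO.trans A) (SPO.trans B))
  (⊎-decidable (_≺?_ A) (_≺?_ B))

_⊕_ : FinPoset → FinPoset → FinPoset
A ⊕ B = alongSplitAt (size A) (size B) (_≺_ A ⊎-< _≺_ B)
  (⊎-<-irreflexive (SPO.irrefl A) (SPO.irrefl B) ∘ ≡⇒Pointwise-≡)
  (⊎-<-transitive (SPO.trans A) (SPO.trans B))
  (⊎-<-decidable (_≺?_ A) (_≺?_ B))

-- Linear extensions of A ⊕ chain m

module ChainOnTop (A : FinPoset) (m : ℕ) where

  private
    a = size A
    _≺⊕_ : Rel (Fin a ⊎ Fin m) _
    _≺⊕_ = _≺_ A ⊎-< Fin._<_

  below-chain : ∀ x j → toℕ x < toℕ (a ↑ʳ j) → _≺_ (A ⊕ chain m) x (a ↑ʳ j)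
  below-chain x j x<j with split a m x
  ... | left i  = on-join⁺ _≺⊕_ {inj₁ i} {inj₂ j} ₁∼₂
  ... | right i = on-join⁺ _≺⊕_ {inj₂ i} {inj₂ j}
                    (₂∼₂ (+-cancelˡ-< a _ _ (subst₂ _<_ (toℕ-↑ʳ a i) (toℕ-↑ʳ a j) x<j)))

  above-chain : ∀ j x → toℕ (a ↑ʳ j) < toℕ x → _≺_ (A ⊕ chain m) (a ↑ʳ j) x
  above-chain j x j<x with split a m x
  ... | left i  = ⊥-elim (<-asym j<x (↑ˡ<↑ʳ i j))
  ... | right i = on-join⁺ _≺⊕_ {inj₂ j} {inj₂ i}
                    (₂∼₂ (+-cancelˡ-< a _ _ (subst₂ _<_ (toℕ-↑ʳ a j) (toℕ-↑ʳ a i) j<x)))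

  extend : (Fin a → Fin a) → Fin (a + m) → Fin (a + m)
  extend σ x = join a m (map₁ σ (splitAt a x))

  extend-cong : ∀ {σ τ} → σ ≗ τ → extend σ ≗ extend τ
  extend-cong σ≗τ x = cong (join a m) (map₁-cong σ≗τ (splitAt a x))

  extend-left : ∀ σ i → extend σ (i ↑ˡ m) ≡ σ i ↑ˡ m
  extend-left σ i = cong (join a m ∘ map₁ σ) (splitAt-↑ˡ a i m)

  extend-right : ∀ σ j → extend σ (a ↑ʳ j) ≡ a ↑ʳ j
  extend-right σ j = cong (join a m ∘ map₁ σ) (splitAt-↑ʳ a m j)

  position-extend-left : ∀ σ i → toℕ (extend σ (i ↑ˡ m)) ≡ toℕ (σ i)
  position-extend-left σ i = trans (cong toℕ (extend-left σ i)) (toℕ-↑ˡ (σ i) m)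

  position-extend-right : ∀ σ j → toℕ (extend σ (a ↑ʳ j)) ≡ a + toℕ j
  position-extend-right σ j = trans (cong toℕ (extend-right σ j)) (toℕ-↑ʳ a j)

  extend-isLinearExtension : ∀ {σ} → IsLinearExtension A σ → IsLinearExtension (A ⊕ chain m) (extend σ)
  extend-isLinearExtension {σ} (σ-injective , σ-surjective , σ-monotone) = injective , surjective , monotone
    where
    injective : ∀ x y → extend σ x ≡ extend σ y → x ≡ y
    injective x y eq with split a m x | split a m y
    ... | left i  | left i′  = cong (_↑ˡ m) (σ-injective i i′
            (↑ˡ-injective m _ _ (trans (sym (extend-left σ i)) (trans eq (extend-left σ i′)))))
    ... | left i  | right j  =
      ⊥-elim (↑ˡ≢↑ʳ (σ i) j (trans (sym (extend-left σ i)) (trans eq (extend-right σ j))))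
    ... | right j | left i   =
      ⊥-elim (↑ˡ≢↑ʳ (σ i) j (trans (sym (extend-left σ i)) (trans (sym eq) (extend-right σ j))))
    ... | right j | right j′ = trans (sym (extend-right σ j)) (trans eq (extend-right σ j′))
    surjective : ∀ p → ∃ λ x → extend σ x ≡ p
    surjective p with split a m p
    ... | right j = a ↑ʳ j , extend-right σ j
    ... | left i with σ-surjective i
    ...   | i′ , refl = i′ ↑ˡ m , extend-left σ i′
    monotone : ∀ x y → _≺_ (A ⊕ chain m) x y → toℕ (extend σ x) < toℕ (extend σ y)
    monotone x y x≺y with split a m x | split a m y
    ... | left i  | left i′  =
      subst₂ _<_ (sym (position-extend-left σ i)) (sym (position-extend-left σ i′))
                 (σ-monotone i i′ (drop-inj₁ (on-join⁻ _≺⊕_ {inj₁ i} {inj₁ i′} x≺y)))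
    ... | left i  | right j  =
      subst₂ _<_ (sym (position-extend-left σ i)) (sym (position-extend-right σ j))
                 (<-≤-trans (toℕ<n (σ i)) (m≤m+n a (toℕ j)))
    ... | right j | right j′ =
      subst₂ _<_ (sym (position-extend-right σ j)) (sym (position-extend-right σ j′))
                 (+-monoʳ-< a (drop-inj₂ (on-join⁻ _≺⊕_ {inj₂ j} {inj₂ j′} x≺y)))
    ... | right j | left i with on-join⁻ _≺⊕_ {inj₂ j} {inj₁ i} x≺y
    ...   | ()

  module Restriction {L : Fin (a + m) → Fin (a + m)} (isLE : IsLinearExtension (A ⊕ chain m) L) where

    private
      L-injective  = proj₁ isLE
      L-surjective = proj₁ (proj₂ isLE)
      L-monotone   = proj₂ (proj₂ isLE)

    chain-fixed : ∀ j → L (a ↑ʳ j) ≡ a ↑ʳ j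
    chain-fixed j = toℕ-injective (≤-antisym (position≤index (A ⊕ chain m) isLE (a ↑ʳ j) (above-chain j))
                                             (index≤position (A ⊕ chain m) isLE (a ↑ʳ j) (λ u → below-chain u j)))

    -- The positions of the chain are taken, so A is mapped into its own positions.
    left-stays-left : ∀ i → ∃ λ i′ → L (i ↑ˡ m) ≡ i′ ↑ˡ m
    left-stays-left i = stay (split a m _) refl
      where
      stay : ∀ {p} → Split a m p → L (i ↑ˡ m) ≡ p → ∃ λ i′ → L (i ↑ˡ m) ≡ i′ ↑ˡ m
      stay (left i′) eq = i′ , eq
      stay (right j) eq = ⊥-elim (↑ˡ≢↑ʳ i j (L-injective _ _ (trans eq (sym (chain-fixed j)))))

    restrict : Fin a → Fin a
    restrict i = proj₁ (left-stays-left i)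

    restrict-spec : ∀ i → L (i ↑ˡ m) ≡ restrict i ↑ˡ m
    restrict-spec i = proj₂ (left-stays-left i)

    position-restrict : ∀ i → toℕ (L (i ↑ˡ m)) ≡ toℕ (restrict i)
    position-restrict i = trans (cong toℕ (restrict-spec i)) (toℕ-↑ˡ (restrict i) m)

    restrict-isLinearExtension : IsLinearExtension A restrict
    restrict-isLinearExtension = injective , surjective , monotone
      where
      injective : ∀ i i′ → restrict i ≡ restrict i′ → i ≡ i′
      injective i i′ eq = ↑ˡ-injective m i i′
        (L-injective _ _ (trans (restrict-spec i) (trans (cong (_↑ˡ m) eq) (sym (restrict-spec i′)))))
      surjective : ∀ p → ∃ λ i → restrict i ≡ p
      surjective p with L-surjective (p ↑ˡ m)
      ... | u , Lu≡p with split a m u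
      ...   | left i  = i , ↑ˡ-injective m _ _ (trans (sym (restrict-spec i)) Lu≡p)
      ...   | right j = ⊥-elim (↑ˡ≢↑ʳ p j (trans (sym Lu≡p) (chain-fixed j)))
      monotone : ∀ i i′ → _≺_ A i i′ → toℕ (restrict i) < toℕ (restrict i′)
      monotone i i′ i≺i′ = subst₂ _<_ (position-restrict i) (position-restrict i′)
        (L-monotone _ _ (on-join⁺ _≺⊕_ {inj₁ i} {inj₁ i′} (₁∼₁ i≺i′)))

    extend-restrict : extend restrict ≗ L
    extend-restrict x with split a m x
    ... | left i  = trans (extend-left restrict i) (sym (restrict-spec i))
    ... | right j = trans (extend-right restrict j) (sym (chain-fixed j))

  extendVec : Vec (Fin a) a → Vec (Fin (a + m)) (a + m)
  extendVec v = tabulate (extend (lookup v))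

  extendVec-injective : ∀ {v w} → extendVec v ≡ extendVec w → v ≡ w
  extendVec-injective {v} {w} eq = trans (sym (tabulate∘lookup v)) (trans (tabulate-cong same) (tabulate∘lookup w))
    where
    same : ∀ i → lookup v i ≡ lookup w i
    same i = ↑ˡ-injective m _ _ (begin
      lookup v i ↑ˡ m                      ≡⟨ extend-left (lookup v) i ⟨
      extend (lookup v) (i ↑ˡ m)           ≡⟨ lookup∘tabulate _ (i ↑ˡ m) ⟨
      lookup (extendVec v) (i ↑ˡ m)        ≡⟨ cong (λ u → lookup u (i ↑ˡ m)) eq ⟩
      lookup (extendVec w) (i ↑ˡ m)        ≡⟨ lookup∘tabulate _ (i ↑ˡ m) ⟩
      extend (lookup w) (i ↑ˡ m)           ≡⟨ extend-left (lookup w) i ⟩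
      lookup w i ↑ˡ m                      ∎)
      where open ≡-Reasoning

  F-chainOnTop : ∀ z₁ z₂ z₃ k ℓ →
                 F (A ⊕ chain m) (z₁ ↑ˡ m) (z₂ ↑ˡ m) (z₃ ↑ˡ m) k ℓ ≡ F A z₁ z₂ z₃ k ℓ
  F-chainOnTop z₁ z₂ z₃ k ℓ = begin
    F (A ⊕ chain m) (z₁ ↑ˡ m) (z₂ ↑ˡ m) (z₃ ↑ˡ m) k ℓ  ≡⟨⟩
    length ys                                        ≡⟨ length-unique-set ys-unique extended-xs-unique (mk⇔ from to) ⟩
    length (map extendVec xs)                        ≡⟨ length-map extendVec xs ⟩
    length xs                                        ≡⟨⟩
    F A z₁ z₂ z₃ k ℓ                                 ∎
    where
    open ≡-Reasoning
    xs = countedVecs A z₁ z₂ z₃ k ℓ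
    ys = countedVecs (A ⊕ chain m) (z₁ ↑ˡ m) (z₂ ↑ˡ m) (z₃ ↑ˡ m) k ℓ
    ys-unique = countedVecs-unique (A ⊕ chain m) (z₁ ↑ˡ m) (z₂ ↑ˡ m) (z₃ ↑ˡ m) k ℓ
    extended-xs-unique = Unique.map⁺ extendVec-injective (countedVecs-unique A z₁ z₂ z₃ k ℓ)
    to : ∀ {v} → v ∈ map extendVec xs → v ∈ ys
    to v∈ with ∈-map⁻ extendVec v∈
    ... | w , w∈ , refl with ∈-countedVecs⁻ {A} {z₁} {z₂} {z₃} {k} {ℓ} w∈
    ...   | isLE , gaps = ∈-countedVecs⁺ {A ⊕ chain m} {z₁ ↑ˡ m} {z₂ ↑ˡ m} {z₃ ↑ˡ m} {k} {ℓ} {extendVec w}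
            ( isLinearExtension-cong (A ⊕ chain m) (sym ∘ lookup∘tabulate (extend (lookup w)))
                (extend-isLinearExtension isLE)
            , Gaps-cong {A} {A ⊕ chain m} (lookup w) (lookup (extendVec w))
                (position z₁) (position z₂) (position z₃) gaps)
      where
      position : ∀ z → toℕ (lookup w z) ≡ toℕ (lookup (extendVec w) (z ↑ˡ m))
      position z = sym (trans (cong toℕ (lookup∘tabulate _ (z ↑ˡ m))) (position-extend-left (lookup w) z))
    from : ∀ {v} → v ∈ ys → v ∈ map extendVec xs
    from {v} v∈ with ∈-countedVecs⁻ {A ⊕ chain m} {z₁ ↑ˡ m} {z₂ ↑ˡ m} {z₃ ↑ˡ m} {k} {ℓ} v∈
    ... | isLE , gaps = subst (_∈ map extendVec xs) (sym v≡) (∈-map⁺ extendVec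
            (∈-countedVecs⁺ {A} {z₁} {z₂} {z₃} {k} {ℓ} {w}
              ( isLinearExtension-cong A (sym ∘ lookup∘tabulate restrict) restrict-isLinearExtension
              , Gaps-cong {A ⊕ chain m} {A} (lookup v) (lookup w) (position z₁) (position z₂) (position z₃) gaps)))
      where
      open Restriction isLE
      w = tabulate restrict
      position : ∀ z → toℕ (lookup v (z ↑ˡ m)) ≡ toℕ (lookup w z)
      position z = trans (position-restrict z) (cong toℕ (sym (lookup∘tabulate restrict z)))
      v≡ : v ≡ extendVec w
      v≡ = trans (sym (tabulate∘lookup v))
             (tabulate-cong λ x → trans (sym (extend-restrict x)) (extend-cong (sym ∘ lookup∘tabulate restrict) x))

  violates-chainOnTop : ∀ z₁ z₂ z₃ k ℓ → Violates A z₁ z₂ z₃ k ℓ →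
                        Violates (A ⊕ chain m) (z₁ ↑ˡ m) (z₂ ↑ˡ m) (z₃ ↑ˡ m) k ℓ
  violates-chainOnTop z₁ z₂ z₃ k ℓ = subst₂ _>_
    (sym (cong₂ _*_ (F-chainOnTop z₁ z₂ z₃ k (ℓ + 2)) (F-chainOnTop z₁ z₂ z₃ (k + 1) ℓ)))
    (sym (cong₂ _*_ (F-chainOnTop z₁ z₂ z₃ k (ℓ + 1)) (F-chainOnTop z₁ z₂ z₃ (k + 1) (ℓ + 1))))

-- Width

ComparableBy : ∀ {X : Set} {ℓ} → Rel X ℓ → X → X → Set ℓ
ComparableBy _<_ x y = x ≡ y ⊎ x < y ⊎ y < x

record ChainCover (P : FinPoset) (w : ℕ) : Set where
  field
    colour     : Fin (size P) → Fin w
    comparable : ∀ x y → colour x ≡ colour y → ComparableBy (_≺_ P) x y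

antichain≤chainCover : ∀ {P w k} → ChainCover P w → HasAntichainOfSize P k → k ≤ w
antichain≤chainCover {P} cover (f , distinct , incomparable) = injective⇒≤ {f = colour ∘ f} injective
  where
  open ChainCover cover
  injective : ∀ {i j} → colour (f i) ≡ colour (f j) → i ≡ j
  injective {i} {j} eq with i ≟ᶠ j
  ... | yes i≡j = i≡j
  ... | no i≢j with comparable (f i) (f j) eq
  ...   | inj₁ fi≡fj        = ⊥-elim (distinct i j i≢j fi≡fj)
  ...   | inj₂ (inj₁ fi≺fj) = ⊥-elim (proj₁ (incomparable i j i≢j) fi≺fj)
  ...   | inj₂ (inj₂ fj≺fi) = ⊥-elim (proj₂ (incomparable i j i≢j) fj≺fi)

comparableBy-map : ∀ {X Y : Set} {ℓ ℓ′} {R : Rel X ℓ} (S : Rel Y ℓ′) (f : X → Y) →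
                   (∀ {x y} → R x y → S (f x) (f y)) →
                   ∀ {x y} → ComparableBy R x y → ComparableBy S (f x) (f y)
comparableBy-map S f f⁺ = Sum.map (cong f) (Sum.map f⁺ f⁺)

comparableBy-splitAt : ∀ {a b ℓ} (R : Rel (Fin a ⊎ Fin b) ℓ) {x y} →
                       ComparableBy R (splitAt a x) (splitAt a y) → ComparableBy (R on splitAt a) x y
comparableBy-splitAt {a} {b} R = Sum.map₁ (splitAt-injective a b)

chain-chainCover : ∀ k w → ChainCover (chain k) (suc w)
chain-chainCover k w = record { colour = const zero ; comparable = λ x y _ → trichotomy (<-cmp x y) }
  where
  trichotomy : ∀ {x y} → Tri (x Fin.< y) (x ≡ y) (y Fin.< x) → ComparableBy Fin._<_ x y
  trichotomy (tri< x<y _ _) = inj₂ (inj₁ x<y)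
  trichotomy (tri≈ _ x≡y _) = inj₁ x≡y
  trichotomy (tri> _ _ y<x) = inj₂ (inj₂ y<x)

⊎ᴾ-chainCover : ∀ {A B v w} → ChainCover A v → ChainCover B w → ChainCover (A ⊎ᴾ B) (v + w)
⊎ᴾ-chainCover {A} {B} {v} {w} coverA coverB = record
  { colour     = c ∘ splitAt (size A)
  ; comparable = λ x y → comparableBy-splitAt R ∘ comparable (splitAt (size A) x) (splitAt (size A) y) }
  where
  module CA = ChainCover coverA
  module CB = ChainCover coverB
  R = Pointwise (_≺_ A) (_≺_ B)
  c : Fin (size A) ⊎ Fin (size B) → Fin (v + w)
  c = join v w ∘ Sum.map CA.colour CB.colour
  comparable : ∀ s t → c s ≡ c t → ComparableBy R s t
  comparable (inj₁ i) (inj₁ i′) eq =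
    comparableBy-map R inj₁ Pointwise.inj₁ (CA.comparable i i′ (inj₁-injective (join-injective v w eq)))
  comparable (inj₂ j) (inj₂ j′) eq =
    comparableBy-map R inj₂ Pointwise.inj₂ (CB.comparable j j′ (inj₂-injective (join-injective v w eq)))
  comparable (inj₁ i) (inj₂ j)  eq with join-injective v w {inj₁ (CA.colour i)} {inj₂ (CB.colour j)} eq
  ... | ()
  comparable (inj₂ j) (inj₁ i)  eq with join-injective v w {inj₂ (CB.colour j)} {inj₁ (CA.colour i)} eq
  ... | ()

-- Chains of A and of B can share a colour, since A lies entirely below B.
⊕-chainCover : ∀ {A B w} → ChainCover A w → ChainCover B w → ChainCover (A ⊕ B) w
⊕-chainCover {A} {B} coverA coverB = record
  { colour     = c ∘ splitAt (size A)
  ; comparable = λ x y → comparableBy-splitAt R ∘ comparable (splitAt (size A) x) (splitAt (size A) y) }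
  where
  module CA = ChainCover coverA
  module CB = ChainCover coverB
  R = _≺_ A ⊎-< _≺_ B
  c = [ CA.colour , CB.colour ]′
  comparable : ∀ s t → c s ≡ c t → ComparableBy R s t
  comparable (inj₁ i) (inj₁ i′) eq = comparableBy-map R inj₁ ₁∼₁ (CA.comparable i i′ eq)
  comparable (inj₁ i) (inj₂ j)  _  = inj₂ (inj₁ ₁∼₂)
  comparable (inj₂ j) (inj₁ i)  _  = inj₂ (inj₂ ₁∼₂)
  comparable (inj₂ j) (inj₂ j′) eq = comparableBy-map R inj₂ ₂∼₂ (CB.comparable j j′ eq)

antichain-⊕ˡ : ∀ {A B k} → HasAntichainOfSize A k → HasAntichainOfSize (A ⊕ B) k
antichain-⊕ˡ {A} {B} (f , distinct , incomparable) =
  (λ i → f i ↑ˡ size B) ,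
  (λ i j i≢j eq → distinct i j i≢j (↑ˡ-injective (size B) (f i) (f j) eq)) ,
  λ i j i≢j → proj₁ (incomparable i j i≢j) ∘ drop-inj₁ ∘ on-join⁻ R {inj₁ (f i)} {inj₁ (f j)} ,
              proj₂ (incomparable i j i≢j) ∘ drop-inj₁ ∘ on-join⁻ R {inj₁ (f j)} {inj₁ (f i)}
  where
  R = _≺_ A ⊎-< _≺_ B

antichain? : ∀ P {k} (f : Fin k → Fin (size P)) →
             Dec ((∀ i j → i ≢ j → f i ≢ f j) × (∀ i j → i ≢ j → Incomparable P (f i) (f j)))
antichain? P f =
  all? (λ i → all? λ j → ¬? (i ≟ᶠ j) →-dec ¬? (f i ≟ᶠ f j)) ×-dec
  all? (λ i → all? λ j → ¬? (i ≟ᶠ j) →-dec (¬? (_≺?_ P (f i) (f j)) ×-dec ¬? (_≺?_ P (f j) (f i))))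

isomorphic⇒size≡ : ∀ {P Q} → Isomorphic P Q → size P ≡ size Q
isomorphic⇒size≡ (f , g , g∘f≗id , f∘g≗id , _) =
  ≤-antisym (injective⇒≤ {f = f} (cancel g g∘f≗id)) (injective⇒≤ {f = g} (cancel f f∘g≗id))
  where
  cancel : ∀ {m n} {h : Fin m → Fin n} (h⁻ : Fin n → Fin m) → (∀ x → h⁻ (h x) ≡ x) →
           ∀ {x y} → h x ≡ h y → x ≡ y
  cancel h⁻ left-inverse {x} {y} eq = trans (sym (left-inverse x)) (trans (cong h⁻ eq) (left-inverse y))

Q : FinPoset
Q = (chain 3 ⊎ᴾ chain 2) ⊎ᴾ chain 1

-- Q has elements 0 < 1 < 2, 3 < 4 and 5: z₁ is the isolated point, z₂ the bottom of
-- the 3-chain and z₃ the top of the 2-chain.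
z₁ z₂ z₃ : Fin (size Q)
z₁ = # 5
z₂ = # 0
z₃ = # 4

Q-antichain : HasAntichainOfSize Q 3
Q-antichain = zs , toWitness {a? = antichain? Q zs} _
  where
  zs = lookup (z₁ ∷ z₂ ∷ z₃ ∷ [])

Q-chainCover : ChainCover Q 3
Q-chainCover = ⊎ᴾ-chainCover (⊎ᴾ-chainCover (chain-chainCover 3 0) (chain-chainCover 2 0)) (chain-chainCover 1 0)

Q⊕chain-width : ∀ m → HasWidth (Q ⊕ chain m) 3
Q⊕chain-width m = antichain-⊕ˡ {Q} {chain m} Q-antichain ,
                  λ _ → antichain≤chainCover (⊕-chainCover Q-chainCover (chain-chainCover m 2))

-- In Q, F(1,3) = 3, F(2,1) = 1, F(1,2) = 2 and F(2,2) = 1.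
Q-violates : Violates Q z₁ z₂ z₃ 1 1
Q-violates = s≤s (s≤s (s≤s z≤n))

Q⊕chain-violation : ∀ m → HasViolation (Q ⊕ chain m)
Q⊕chain-violation m = z₁ ↑ˡ m , z₂ ↑ˡ m , z₃ ↑ˡ m , (λ ()) , (λ ()) , (λ ()) , 1 , 1 , s≤s z≤n , s≤s z≤n ,
  ChainOnTop.violates-chainOnTop Q m z₁ z₂ z₃ 1 1 Q-violates

proposition7p1 : Σ (ℕ → FinPoset) λ P →
    (∀ i j → i ≢ j → ¬ Isomorphic (P i) (P j)) ×
    (∀ i → HasWidth (P i) 3 × HasViolation (P i))
proposition7p1 = (λ m → Q ⊕ chain m) ,
  (λ i j i≢j → i≢j ∘ +-cancelˡ-≡ 6 i j ∘ isomorphic⇒size≡ {Q ⊕ chain i} {Q ⊕ chain j}) ,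
  λ m → Q⊕chain-width m , Q⊕chain-violation m
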